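{- Let $A: 2y^2=x^3+x$ and $E: y^2=x^3-x$ over $\mathbb{Q}$, so that the $4$-torsion points of $A$ and $E$ are defined over $\mathbb{Q}(\zeta_8)$. Let $\kappa\in\mathrm{Gal}(\mathbb{Q}(\zeta_8)/\mathbb{Q})$ be the element with $\kappa(\zeta_8)=\zeta_8^5$, and consider the map $\kappa+1:A[4]\to A[4]$, $x\mapsto x^\kappa+x$ (and similarly on $E[4]$). Then $$(\kappa+1)A[4]=A[4][\kappa+1]=A[2],\qquad(\kappa+1)E[4]=E[4][\kappa+1]=E[2],$$ where $(\kappa+1)A[4]$ and $A[4][\kappa+1]$ denote the image and kernel of $\kappa+1$ on $A[4]$ (and similarly for $E$).
   Context: $\zeta_8$ is a primitive $8$th root of unity; $A[m]$, $E[m]$ denote $m$-torsion subgroups over $\overline{\mathbb{Q}}$. -}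

module Defs where

open import Data.Nat using (ℕ; zero; suc)
open import Data.Integer using (+_; -[1+_])
open import Data.Rational as Q using (ℚ; 0ℚ; 1ℚ; ≢-nonZero)
  renaming (_+_ to _+ℚ_; _*_ to _*ℚ_; -_ to -ℚ_; _-_ to _-ℚ_)
import Data.Rational.Properties as QP
open import Data.Product using (_×_; _,_; ∃-syntax)
open import Relation.Binary.PropositionalEquality using (_≡_; _≢_; refl; cong)
open import Relation.Nullary using (Dec; yes; no; ¬_)
open import Function.Bundles using (_⇔_)
open import Data.Unit using (⊤)

-- The cyclotomic field K = ℚ(ζ₈) = ℚ[z]/(z⁴ + 1), elements written
-- a + b ζ + c ζ² + d ζ³ with a b c d ∈ ℚ (ζ = ζ₈).

record K : Set where
  constructor mkK
  field a b c d : ℚ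

open K public

_≟K_ : (u v : K) → Dec (u ≡ v)
mkK a₁ b₁ c₁ d₁ ≟K mkK a₂ b₂ c₂ d₂
  with a₁ QP.≟ a₂ | b₁ QP.≟ b₂ | c₁ QP.≟ c₂ | d₁ QP.≟ d₂
... | yes refl | yes refl | yes refl | yes refl = yes refl
... | no p | _ | _ | _ = no λ { refl → p refl }
... | yes _ | no p | _ | _ = no λ { refl → p refl }
... | yes _ | yes _ | no p | _ = no λ { refl → p refl }
... | yes _ | yes _ | yes _ | no p = no λ { refl → p refl }

fromℚ : ℚ → K
fromℚ q = mkK q 0ℚ 0ℚ 0ℚ

0K 1K ζ₈ : K
0K = fromℚ 0ℚ
1K = fromℚ 1ℚ
ζ₈ = mkK 0ℚ 1ℚ 0ℚ 0ℚ

_+K_ : K → K → K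
mkK a₁ b₁ c₁ d₁ +K mkK a₂ b₂ c₂ d₂ =
  mkK (a₁ +ℚ a₂) (b₁ +ℚ b₂) (c₁ +ℚ c₂) (d₁ +ℚ d₂)

-K_ : K → K
-K mkK a₁ b₁ c₁ d₁ = mkK (-ℚ a₁) (-ℚ b₁) (-ℚ c₁) (-ℚ d₁)

_-K_ : K → K → K
u -K v = u +K (-K v)

-- multiplication using ζ⁴ = -1
_*K_ : K → K → K
mkK a₁ b₁ c₁ d₁ *K mkK a₂ b₂ c₂ d₂ =
  mkK (a₁ *ℚ a₂ -ℚ (b₁ *ℚ d₂ +ℚ c₁ *ℚ c₂ +ℚ d₁ *ℚ b₂))
      (a₁ *ℚ b₂ +ℚ b₁ *ℚ a₂ -ℚ (c₁ *ℚ d₂ +ℚ d₁ *ℚ c₂))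
      (a₁ *ℚ c₂ +ℚ b₁ *ℚ b₂ +ℚ c₁ *ℚ a₂ -ℚ (d₁ *ℚ d₂))
      (a₁ *ℚ d₂ +ℚ b₁ *ℚ c₂ +ℚ c₁ *ℚ b₂ +ℚ d₁ *ℚ a₂)

invℚ : ℚ → ℚ
invℚ q with q QP.≟ 0ℚ
... | yes _ = 0ℚ
... | no q≢0 = Q.1/_ q {{≢-nonZero q≢0}}

-- The automorphism σ : ζ ↦ -ζ  (= ζ⁵, this is κ of the paper)
κ : K → K
κ (mkK a₁ b₁ c₁ d₁) = mkK a₁ (-ℚ b₁) c₁ (-ℚ d₁)

-- complex conjugation on ℚ(i) = ℚ(ζ²) part: ζ² ↦ -ζ²  (ζ ↦ ζ³ restricted)
-- Inverse: write u = p + ζ q with p, q ∈ ℚ(ζ²). Then u·κ(u) = p² - ζ² q² ∈ ℚ(ζ²),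
-- and for r = s + t ζ² one has r·(s - t ζ²) = s² + t².
invK : K → K
invK u = (κ u *K r̄) *K fromℚ (invℚ (a n))
  where
    r  = u *K κ u                -- lies in ℚ(ζ²)
    r̄  = mkK (a r) 0ℚ (-ℚ (c r)) 0ℚ
    n  = r *K r̄                  -- lies in ℚ
-- total inverse on K (0 ↦ 0)

_/K_ : K → K → K
u /K v = u *K invK v

2K 3K : K
2K = fromℚ ((+ 2 Q./ 1))
3K = fromℚ ((+ 3 Q./ 1))

-- Curves  α y² = x³ + β x  over ℚ, points with coordinates in K.

record CurveData : Set where
  constructor curve
  field α β : ℚ

open CurveData public

data Pt : Set where
  O   : Pt
  aff : K → K → Pt

OnCurve : CurveData → Pt → Set
OnCurve C O = ⊤
OnCurve C (aff x y) =
  fromℚ (α C) *K (y *K y) ≡ (x *K (x *K x)) +K (fromℚ (β C) *K x)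

-- The group law (chord-and-tangent) on α y² = x³ + β x, with O as identity.
-- On points satisfying OnCurve this is the usual group law of the curve.
addPt : CurveData → Pt → Pt → Pt
addPt C O Q = Q
addPt C P O = P
addPt C (aff x₁ y₁) (aff x₂ y₂) with x₁ ≟K x₂
... | no _ =
  let λ₁ = (y₂ -K y₁) /K (x₂ -K x₁)
      x₃ = ((fromℚ (α C) *K λ₁) *K λ₁) -K (x₁ +K x₂)
  in aff x₃ (-K (y₁ +K (λ₁ *K (x₃ -K x₁))))
... | yes _ with (y₁ +K y₂) ≟K 0K
...   | yes _ = O
...   | no _ =
  let λ₁ = ((3K *K (x₁ *K x₁)) +K fromℚ (β C)) /K ((2K *K fromℚ (α C)) *K y₁)
      x₃ = ((fromℚ (α C) *K λ₁) *K λ₁) -K (x₁ +K x₁)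
  in aff x₃ (-K (y₁ +K (λ₁ *K (x₃ -K x₁))))

mulPt : CurveData → ℕ → Pt → Pt
mulPt C zero    P = O
mulPt C (suc m) P = addPt C P (mulPt C m P)

Tors : CurveData → ℕ → Pt → Set
Tors C m P = OnCurve C P × mulPt C m P ≡ O

κPt : Pt → Pt
κPt O = O
κPt (aff x y) = aff (κ x) (κ y)

κ+1 : CurveData → Pt → Pt
κ+1 C P = addPt C (κPt P) P

Image4 : CurveData → Pt → Set
Image4 C Q = ∃[ P ] (Tors C 4 P × κ+1 C P ≡ Q)

Kernel4 : CurveData → Pt → Set
Kernel4 C P = Tors C 4 P × κ+1 C P ≡ O

_≐_ : (Pt → Set) → (Pt → Set) → Set
S ≐ T = ∀ P → S P ⇔ T P

curveA curveE : CurveData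
curveA = curve ((+ 2 Q./ 1)) 1ℚ
curveE = curve 1ℚ (-ℚ 1ℚ)

-- If [2]P = O then
-- y = 0, so x is a root of x³ + β x.  If [4]P = O and y ≠ 0 then [2]P = (e, 0) for
-- such a root e, and x is a root of x² - 2ex - 2e² - β.  K is a field (an element
-- u = p + ζ q with p, q ∈ ℚ(i) has u κ(u) = p² - i q² ≠ 0, since i is not a square
-- in ℚ(i)), and over K all these polynomials split into explicit linear factors.
-- This lists the 4 points of C[2] and the 16 points of C[4] of both curves, and
-- κ + 1 is evaluated on each of them.

module Submission where

open import Defs
open import Defs using () renaming
  (_+K_ to infixl 6 _+_; _-K_ to infixl 6 _-_; _*K_ to infixl 7 _*_; -K_ to infix 8 -_)
open import Algebra.Bundles using (CommutativeRing)
import Algebra.Properties.Group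
open import Data.Fin using (#_)
open import Data.List.Base using (List; []; _∷_; _++_; map; foldr; concatMap)
open import Data.List.Membership.Propositional using (_∈_; lose)
open import Data.List.Membership.Propositional.Properties
  using (∈-map⁺; ∈-map⁻; ∈-++⁺ˡ; ∈-++⁺ʳ; ∈-concatMap⁺)
import Data.List.Properties as List
open import Data.List.Relation.Unary.All as All using (All; []; _∷_; all?)
open import Data.List.Relation.Unary.Any using (Any; here; there; any?; satisfied)
open import Data.Nat.Base as ℕ using (ℕ; suc)
open import Data.Product.Base using (_×_; _,_; proj₁; proj₂; ∃; ∃-syntax)
open import Data.Rational.Base as ℚ using (ℚ; mkℚ; 0ℚ; 1ℚ; NonNegative; Positive)
import Data.Rational.Properties as ℚ
open import Data.Sum.Base using (_⊎_; inj₁; inj₂; [_,_]′)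
open import Data.Unit.Base using (tt)
open import Data.Vec.Base using (Vec; []; _∷_)
open import Function.Bundles using (mk⇔)
open import Level using (0ℓ)
open import Relation.Binary.Definitions using (DecidableEquality)
open import Relation.Binary.PropositionalEquality
open import Relation.Nullary.Decidable.Core
  using (Dec; yes; no; dec⇒maybe; map′; _×-dec_; _→-dec_; from-yes)
open import Relation.Nullary.Negation.Core using (contradiction)
open import Tactic.RingSolver using (solve-∀)
import Tactic.RingSolver.NonReflective as NonReflective
open import Tactic.RingSolver.Core.AlmostCommutativeRing
  using (AlmostCommutativeRing; fromCommutativeRing)
open import Tactic.RingSolver.Core.Expression using (Expr; Κ; Ι; _⊕_; _⊗_; ⊝_)

module Rational where

  open import Data.Integer.Base as ℤ using (+_; -[1+_])
  import Data.Integer.Properties as ℤ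
  open import Data.Nat.Coprimality using (Coprime; recompute)
  open import Data.Nat.Divisibility using (_∣_; divides)
  import Data.Nat.Properties as ℕ
  open import Data.Nat.Primality using (euclidsLemma; prime[2])
  import Data.Nat.Tactic.RingSolver as ℕ
  open import Data.Empty using (⊥-elim)
  import Data.Rational.Unnormalised.Base as ℚᵘ
  import Data.Rational.Unnormalised.Properties as ℚᵘ
  module ℚ-+ = Algebra.Properties.Group ℚ.+-0-group

  ℚ-ring : AlmostCommutativeRing 0ℓ 0ℓ
  ℚ-ring = fromCommutativeRing ℚ.+-*-commutativeRing (λ x → dec⇒maybe (0ℚ ℚ.≟ x))

  2ℚ : ℚ
  2ℚ = + 2 ℚ./ 1

  *-zero-product : ∀ p q → p ℚ.* q ≡ 0ℚ → p ≡ 0ℚ ⊎ q ≡ 0ℚ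
  *-zero-product p q pq≡0 with p ℚ.≟ 0ℚ
  ... | yes p≡0 = inj₁ p≡0
  ... | no p≢0 = inj₂ (begin
    q                    ≡⟨ ℚ.*-identityˡ q ⟨
    1ℚ ℚ.* q             ≡⟨ cong (ℚ._* q) (ℚ.*-inverseˡ p) ⟨
    (p⁻¹ ℚ.* p) ℚ.* q    ≡⟨ ℚ.*-assoc p⁻¹ p q ⟩
    p⁻¹ ℚ.* (p ℚ.* q)    ≡⟨ cong (p⁻¹ ℚ.*_) pq≡0 ⟩
    p⁻¹ ℚ.* 0ℚ           ≡⟨ ℚ.*-zeroʳ p⁻¹ ⟩
    0ℚ                   ∎)
    where
    open ≡-Reasoning
    instance _ = ℚ.≢-nonZero p≢0
    p⁻¹ = ℚ.1/ p

  square≡0⇒≡0 : ∀ p → p ℚ.* p ≡ 0ℚ → p ≡ 0ℚ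
  square≡0⇒≡0 p p²≡0 = [ (λ e → e) , (λ e → e) ]′ (*-zero-product p p p²≡0)

  square-pos : ∀ p → p ≢ 0ℚ → Positive (p ℚ.* p)
  square-pos p@(mkℚ (+ 0)      _ _) p≢0 = contradiction (ℚ.↥p≡0⇒p≡0 p refl) p≢0
  square-pos p@(mkℚ (+ suc _)  _ _) _   = ℚ.pos*pos⇒pos p p
  square-pos p@(mkℚ -[1+ _ ]   _ _) _   = ℚ.neg*neg⇒pos p p

  square-nonNeg : ∀ p → NonNegative (p ℚ.* p)
  square-nonNeg p with p ℚ.≟ 0ℚ
  ... | yes refl = _
  ... | no p≢0   = ℚ.pos⇒nonNeg (p ℚ.* p) {{square-pos p p≢0}}

  square+nonNeg≡0⇒≡0 : ∀ p q → .{{NonNegative q}} → p ℚ.* p ℚ.+ q ≡ 0ℚ → p ≡ 0ℚ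
  square+nonNeg≡0⇒≡0 p q p²+q≡0 with p ℚ.≟ 0ℚ
  ... | yes p≡0 = p≡0
  ... | no p≢0   = contradiction (subst Positive p²+q≡0 p²+q>0) λ ()
    where
    p²+q>0 : Positive (p ℚ.* p ℚ.+ q)
    p²+q>0 = ℚ.pos+nonNeg⇒pos (p ℚ.* p) {{square-pos p p≢0}} q

  even-square⇒even : ∀ m → 2 ∣ m ℕ.* m → 2 ∣ m
  even-square⇒even m 2∣m² = [ (λ 2∣m → 2∣m) , (λ 2∣m → 2∣m) ]′ (euclidsLemma m m prime[2] 2∣m²)

  square≢2*square : ∀ m n → Coprime m n → m ℕ.* m ≢ 2 ℕ.* (n ℕ.* n)
  square≢2*square m n coprime m²≡2n²
    with even-square⇒even m (divides (n ℕ.* n) (trans m²≡2n² (ℕ.*-comm 2 (n ℕ.* n))))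
  ... | divides k refl = contradiction (coprime (divides k refl , 2∣n)) λ ()
    where
    regroup : ∀ k → k ℕ.* 2 ℕ.* (k ℕ.* 2) ≡ 2 ℕ.* (2 ℕ.* (k ℕ.* k))
    regroup = ℕ.solve-∀
    n²≡2k² : n ℕ.* n ≡ 2 ℕ.* (k ℕ.* k)
    n²≡2k² = ℕ.*-cancelˡ-≡ (n ℕ.* n) (2 ℕ.* (k ℕ.* k)) 2 (trans (sym m²≡2n²) (regroup k))
    2∣n : 2 ∣ n
    2∣n = even-square⇒even n (divides (k ℕ.* k) (trans n²≡2k² (ℕ.*-comm 2 (k ℕ.* k))))

  square≢2 : ∀ p → p ℚ.* p ≢ 2ℚ
  square≢2 p@(mkℚ n d-1 coprime) p²≡2 =
    square≢2*square ℤ.∣ n ∣ (suc d-1) (recompute coprime) (begin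
      ℤ.∣ n ∣ ℕ.* ℤ.∣ n ∣       ≡⟨ ℤ.abs-* n n ⟨
      ℤ.∣ n ℤ.* n ∣             ≡⟨ cong ℤ.∣_∣ (ℤ.*-identityʳ (n ℤ.* n)) ⟨
      ℤ.∣ n ℤ.* n ℤ.* + 1 ∣     ≡⟨ cong ℤ.∣_∣ cross-multiplied ⟩
      2 ℕ.* (suc d-1 ℕ.* suc d-1) ∎)
    where
    open ≡-Reasoning
    cross-multiplied : n ℤ.* n ℤ.* + 1 ≡ + 2 ℤ.* + (suc d-1 ℕ.* suc d-1)
    cross-multiplied with ℚᵘ.≃-trans (ℚᵘ.≃-sym (ℚ.toℚᵘ-homo-* p p)) (ℚ.toℚᵘ-cong p²≡2)
    ... | ℚᵘ.*≡* eq = eq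

  2*square≡square⇒≡0 : ∀ p q → 2ℚ ℚ.* (p ℚ.* p) ≡ q ℚ.* q → q ≡ 0ℚ
  2*square≡square⇒≡0 p q 2p²≡q² with p ℚ.≟ 0ℚ
  ... | yes refl = square≡0⇒≡0 q (sym 2p²≡q²)
  ... | no p≢0   = ⊥-elim (square≢2 (q ℚ.* p⁻¹) (begin
    (q ℚ.* p⁻¹) ℚ.* (q ℚ.* p⁻¹)          ≡⟨ regroup q p⁻¹ ⟩
    (q ℚ.* q) ℚ.* (p⁻¹ ℚ.* p⁻¹)          ≡⟨ cong (ℚ._* (p⁻¹ ℚ.* p⁻¹)) 2p²≡q² ⟨
    (2ℚ ℚ.* (p ℚ.* p)) ℚ.* (p⁻¹ ℚ.* p⁻¹) ≡⟨ regroup′ p p⁻¹ ⟩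
    2ℚ ℚ.* ((p ℚ.* p⁻¹) ℚ.* (p ℚ.* p⁻¹)) ≡⟨ cong (λ r → 2ℚ ℚ.* (r ℚ.* r)) (ℚ.*-inverseʳ p) ⟩
    2ℚ                                  ∎))
    where
    open ≡-Reasoning
    instance _ = ℚ.≢-nonZero p≢0
    p⁻¹ = ℚ.1/ p
    regroup : ∀ x y → (x ℚ.* y) ℚ.* (x ℚ.* y) ≡ (x ℚ.* x) ℚ.* (y ℚ.* y)
    regroup = solve-∀ ℚ-ring
    regroup′ : ∀ x y → (2ℚ ℚ.* (x ℚ.* x)) ℚ.* (y ℚ.* y) ≡ 2ℚ ℚ.* ((x ℚ.* y) ℚ.* (x ℚ.* y))
    regroup′ = solve-∀ ℚ-ring

  -- In ℚ(i): (e + f i)² = i N² says e² = f² and 2ef = N², and i is not a square.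
  e²≡f²∧2ef≡N²⇒N≡0 : ∀ e f N → e ℚ.* e ≡ f ℚ.* f → 2ℚ ℚ.* (e ℚ.* f) ≡ N ℚ.* N → N ≡ 0ℚ
  e²≡f²∧2ef≡N²⇒N≡0 e f N e²≡f² 2ef≡N² =
    [ e-f≡0⇒N≡0 , e+f≡0⇒N≡0 ]′ (*-zero-product (e ℚ.- f) (e ℚ.+ f) (begin
      (e ℚ.- f) ℚ.* (e ℚ.+ f)   ≡⟨ difference-of-squares e f ⟩
      e ℚ.* e ℚ.- f ℚ.* f       ≡⟨ cong (ℚ._- f ℚ.* f) e²≡f² ⟩
      f ℚ.* f ℚ.- f ℚ.* f       ≡⟨ ℚ.+-inverseʳ (f ℚ.* f) ⟩
      0ℚ                        ∎))
    where
    open ≡-Reasoning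
    difference-of-squares : ∀ x y → (x ℚ.- y) ℚ.* (x ℚ.+ y) ≡ x ℚ.* x ℚ.- y ℚ.* y
    difference-of-squares = solve-∀ ℚ-ring
    cancel : ∀ x → 2ℚ ℚ.* (x ℚ.* ℚ.- x) ℚ.+ 2ℚ ℚ.* (x ℚ.* x) ≡ 0ℚ
    cancel = solve-∀ ℚ-ring

    e-f≡0⇒N≡0 : e ℚ.- f ≡ 0ℚ → N ≡ 0ℚ
    e-f≡0⇒N≡0 e-f≡0 = 2*square≡square⇒≡0 f N (begin
      2ℚ ℚ.* (f ℚ.* f) ≡⟨ cong (λ x → 2ℚ ℚ.* (x ℚ.* f)) (ℚ-+.x∙y⁻¹≈ε⇒x≈y e f e-f≡0) ⟨
      2ℚ ℚ.* (e ℚ.* f) ≡⟨ 2ef≡N² ⟩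
      N ℚ.* N          ∎)

    e+f≡0⇒N≡0 : e ℚ.+ f ≡ 0ℚ → N ≡ 0ℚ
    e+f≡0⇒N≡0 e+f≡0 = square+nonNeg≡0⇒≡0 N (2ℚ ℚ.* (e ℚ.* e)) {{nonNeg}} (begin
      N ℚ.* N ℚ.+ 2ℚ ℚ.* (e ℚ.* e)             ≡⟨ cong (ℚ._+ 2ℚ ℚ.* (e ℚ.* e)) 2ef≡N² ⟨
      2ℚ ℚ.* (e ℚ.* f) ℚ.+ 2ℚ ℚ.* (e ℚ.* e)    ≡⟨ cong (λ x → 2ℚ ℚ.* (e ℚ.* x) ℚ.+ 2ℚ ℚ.* (e ℚ.* e))
                                                       (ℚ-+.inverseʳ-unique e f e+f≡0) ⟩
      2ℚ ℚ.* (e ℚ.* ℚ.- e) ℚ.+ 2ℚ ℚ.* (e ℚ.* e) ≡⟨ cancel e ⟩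
      0ℚ                                         ∎)
      where nonNeg = ℚ.nonNeg*nonNeg⇒nonNeg 2ℚ (e ℚ.* e) {{square-nonNeg e}}

open Rational using (ℚ-ring; 2ℚ; square-nonNeg; square+nonNeg≡0⇒≡0; e²≡f²∧2ef≡N²⇒N≡0)

module ℚ-Solver = NonReflective ℚ-ring
open ℚ-Solver.Ops using (prove) renaming (⟦_⟧ to ⟦_⟧ℚ; ⟦_⇓⟧ to ⟦_⇓⟧ℚ)

-- Elements of K with solver expressions as coordinates.  The operations repeat
-- the formulas of Defs, so that evaluating them is definitionally the arithmetic of K.
record Kᴱ (n : ℕ) : Set where
  constructor ⟨_,_,_,_⟩
  field aᴱ bᴱ cᴱ dᴱ : Expr ℚ n

open Kᴱ

module _ {n : ℕ} where

  infixl 6 _⊞_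
  infixl 7 _⊠_

  _⊞_ _⊠_ : Kᴱ n → Kᴱ n → Kᴱ n
  ⟨ a₁ , b₁ , c₁ , d₁ ⟩ ⊞ ⟨ a₂ , b₂ , c₂ , d₂ ⟩ = ⟨ a₁ ⊕ a₂ , b₁ ⊕ b₂ , c₁ ⊕ c₂ , d₁ ⊕ d₂ ⟩
  ⟨ a₁ , b₁ , c₁ , d₁ ⟩ ⊠ ⟨ a₂ , b₂ , c₂ , d₂ ⟩ =
    ⟨ a₁ ⊗ a₂ ⊕ ⊝ (b₁ ⊗ d₂ ⊕ c₁ ⊗ c₂ ⊕ d₁ ⊗ b₂)
    , a₁ ⊗ b₂ ⊕ b₁ ⊗ a₂ ⊕ ⊝ (c₁ ⊗ d₂ ⊕ d₁ ⊗ c₂)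
    , a₁ ⊗ c₂ ⊕ b₁ ⊗ b₂ ⊕ c₁ ⊗ a₂ ⊕ ⊝ (d₁ ⊗ d₂)
    , a₁ ⊗ d₂ ⊕ b₁ ⊗ c₂ ⊕ c₁ ⊗ b₂ ⊕ d₁ ⊗ a₂ ⟩

  ⊟_ κᴱ : Kᴱ n → Kᴱ n
  ⊟ ⟨ a , b , c , d ⟩ = ⟨ ⊝ a , ⊝ b , ⊝ c , ⊝ d ⟩
  κᴱ ⟨ a , b , c , d ⟩ = ⟨ a , ⊝ b , c , ⊝ d ⟩

  constᴱ : K → Kᴱ n
  constᴱ (mkK a b c d) = ⟨ Κ a , Κ b , Κ c , Κ d ⟩

  fromℚᴱ : Expr ℚ n → Kᴱ n
  fromℚᴱ p = ⟨ p , Κ 0ℚ , Κ 0ℚ , Κ 0ℚ ⟩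

  ⟦_⟧ᴷ : Kᴱ n → Vec ℚ n → K
  ⟦ ⟨ a , b , c , d ⟩ ⟧ᴷ ρ = mkK (⟦ a ⟧ℚ ρ) (⟦ b ⟧ℚ ρ) (⟦ c ⟧ℚ ρ) (⟦ d ⟧ℚ ρ)

K-≡ : ∀ {u v} → a u ≡ a v → b u ≡ b v → c u ≡ c v → d u ≡ d v → u ≡ v
K-≡ refl refl refl refl = refl

-- The hypotheses compare the normal forms of the coordinates, so they hold by refl
-- whenever e₁ and e₂ are equal as polynomial expressions.
by-coordinates : ∀ {n} ρ (e₁ e₂ : Kᴱ n) →
  ⟦ aᴱ e₁ ⇓⟧ℚ ρ ≡ ⟦ aᴱ e₂ ⇓⟧ℚ ρ → ⟦ bᴱ e₁ ⇓⟧ℚ ρ ≡ ⟦ bᴱ e₂ ⇓⟧ℚ ρ →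
  ⟦ cᴱ e₁ ⇓⟧ℚ ρ ≡ ⟦ cᴱ e₂ ⇓⟧ℚ ρ → ⟦ dᴱ e₁ ⇓⟧ℚ ρ ≡ ⟦ dᴱ e₂ ⇓⟧ℚ ρ →
  ⟦ e₁ ⟧ᴷ ρ ≡ ⟦ e₂ ⟧ᴷ ρ
by-coordinates ρ ⟨ a₁ , b₁ , c₁ , d₁ ⟩ ⟨ a₂ , b₂ , c₂ , d₂ ⟩ a≡ b≡ c≡ d≡ =
  K-≡ (prove ρ a₁ a₂ a≡) (prove ρ b₁ b₂ b≡) (prove ρ c₁ c₂ c≡) (prove ρ d₁ d₂ d≡)

coordinates : K → K → K → Vec ℚ 12
coordinates u v w = a u ∷ b u ∷ c u ∷ d u ∷ a v ∷ b v ∷ c v ∷ d v ∷ a w ∷ b w ∷ c w ∷ d w ∷ []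

uᴱ vᴱ wᴱ : Kᴱ 12
uᴱ = ⟨ Ι (# 0) , Ι (# 1) , Ι (# 2)  , Ι (# 3)  ⟩
vᴱ = ⟨ Ι (# 4) , Ι (# 5) , Ι (# 6)  , Ι (# 7)  ⟩
wᴱ = ⟨ Ι (# 8) , Ι (# 9) , Ι (# 10) , Ι (# 11) ⟩

+-assoc : ∀ u v w → (u + v) + w ≡ u + (v + w)
+-assoc u v w = by-coordinates (coordinates u v w) (uᴱ ⊞ vᴱ ⊞ wᴱ) (uᴱ ⊞ (vᴱ ⊞ wᴱ)) refl refl refl refl

+-comm : ∀ u v → u + v ≡ v + u
+-comm u v = by-coordinates (coordinates u v 0K) (uᴱ ⊞ vᴱ) (vᴱ ⊞ uᴱ) refl refl refl refl

+-identityˡ : ∀ u → 0K + u ≡ u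
+-identityˡ u = by-coordinates (coordinates u 0K 0K) (constᴱ 0K ⊞ uᴱ) uᴱ refl refl refl refl

+-identityʳ : ∀ u → u + 0K ≡ u
+-identityʳ u = by-coordinates (coordinates u 0K 0K) (uᴱ ⊞ constᴱ 0K) uᴱ refl refl refl refl

-‿inverseˡ : ∀ u → - u + u ≡ 0K
-‿inverseˡ u = by-coordinates (coordinates u 0K 0K) (⊟ uᴱ ⊞ uᴱ) (constᴱ 0K) refl refl refl refl

-‿inverseʳ : ∀ u → u - u ≡ 0K
-‿inverseʳ u = by-coordinates (coordinates u 0K 0K) (uᴱ ⊞ ⊟ uᴱ) (constᴱ 0K) refl refl refl refl

*-assoc : ∀ u v w → (u * v) * w ≡ u * (v * w)
*-assoc u v w = by-coordinates (coordinates u v w) (uᴱ ⊠ vᴱ ⊠ wᴱ) (uᴱ ⊠ (vᴱ ⊠ wᴱ)) refl refl refl refl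

*-comm : ∀ u v → u * v ≡ v * u
*-comm u v = by-coordinates (coordinates u v 0K) (uᴱ ⊠ vᴱ) (vᴱ ⊠ uᴱ) refl refl refl refl

*-identityˡ : ∀ u → 1K * u ≡ u
*-identityˡ u = by-coordinates (coordinates u 0K 0K) (constᴱ 1K ⊠ uᴱ) uᴱ refl refl refl refl

*-identityʳ : ∀ u → u * 1K ≡ u
*-identityʳ u = by-coordinates (coordinates u 0K 0K) (uᴱ ⊠ constᴱ 1K) uᴱ refl refl refl refl

*-distribˡ-+ : ∀ u v w → u * (v + w) ≡ u * v + u * w
*-distribˡ-+ u v w =
  by-coordinates (coordinates u v w) (uᴱ ⊠ (vᴱ ⊞ wᴱ)) (uᴱ ⊠ vᴱ ⊞ uᴱ ⊠ wᴱ) refl refl refl refl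

*-distribʳ-+ : ∀ u v w → (v + w) * u ≡ v * u + w * u
*-distribʳ-+ u v w =
  by-coordinates (coordinates u v w) ((vᴱ ⊞ wᴱ) ⊠ uᴱ) (vᴱ ⊠ uᴱ ⊞ wᴱ ⊠ uᴱ) refl refl refl refl

K-commutativeRing : CommutativeRing 0ℓ 0ℓ
K-commutativeRing = record
  { Carrier = K ; _≈_ = _≡_ ; _+_ = _+_ ; _*_ = _*_ ; -_ = (-_) ; 0# = 0K ; 1# = 1K
  ; isCommutativeRing = record
    { isRing = record
      { +-isAbelianGroup = record
        { isGroup = record
          { isMonoid = record
            { isSemigroup = record
              { isMagma = record { isEquivalence = isEquivalence ; ∙-cong = cong₂ _+_ }
              ; assoc = +-assoc }
            ; identity = +-identityˡ , +-identityʳ }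
          ; inverse = -‿inverseˡ , -‿inverseʳ
          ; ⁻¹-cong = cong (-_) }
        ; comm = +-comm }
      ; *-cong = cong₂ _*_
      ; *-assoc = *-assoc
      ; *-identity = *-identityˡ , *-identityʳ
      ; distrib = *-distribˡ-+ , *-distribʳ-+ }
    ; *-comm = *-comm } }

K-ring : AlmostCommutativeRing 0ℓ 0ℓ
K-ring = fromCommutativeRing K-commutativeRing (λ u → dec⇒maybe (0K ≟K u))

module K-+ = Algebra.Properties.Group (CommutativeRing.+-group K-commutativeRing)

fromℚ-* : ∀ p q → fromℚ p * fromℚ q ≡ fromℚ (p ℚ.* q)
fromℚ-* p q = by-coordinates (coordinates (fromℚ p) (fromℚ q) 0K)
  (fromℚᴱ (aᴱ uᴱ) ⊠ fromℚᴱ (aᴱ vᴱ)) (fromℚᴱ (aᴱ uᴱ ⊗ aᴱ vᴱ)) refl refl refl refl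

-- Conjugation of ℚ(i) = ℚ(ζ²) ⊆ K, applied after discarding the odd coordinates.
i-conjugate : K → K
i-conjugate r = mkK (a r) 0ℚ (ℚ.- c r) 0ℚ

i-norm : ∀ s t → mkK s 0ℚ t 0ℚ * i-conjugate (mkK s 0ℚ t 0ℚ) ≡ fromℚ (s ℚ.* s ℚ.+ t ℚ.* t)
i-norm s t = by-coordinates (coordinates (mkK s 0ℚ t 0ℚ) 0K 0K)
  (⟨ s′ , Κ 0ℚ , t′ , Κ 0ℚ ⟩ ⊠ ⟨ s′ , Κ 0ℚ , ⊝ t′ , Κ 0ℚ ⟩) (fromℚᴱ (s′ ⊗ s′ ⊕ t′ ⊗ t′))
  refl refl refl refl
  where s′ = aᴱ uᴱ; t′ = cᴱ uᴱ

κ-norm-even : ∀ u → b (u * κ u) ≡ 0ℚ × d (u * κ u) ≡ 0ℚ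
κ-norm-even u = prove ρ (bᴱ (uᴱ ⊠ κᴱ uᴱ)) (Κ 0ℚ) refl , prove ρ (dᴱ (uᴱ ⊠ κᴱ uᴱ)) (Κ 0ℚ) refl
  where ρ = coordinates u 0K 0K

-- Writing u = p + ζ q with p, q ∈ ℚ(i), one has u κ(u) = p² - i q²; if this
-- vanishes then (p q̄)² = i |q|⁴, and e + f i = p q̄, N = |q|².
κ-norm≡0⇒odd≡0 : ∀ u → a (u * κ u) ≡ 0ℚ → c (u * κ u) ≡ 0ℚ → b u ≡ 0ℚ × d u ≡ 0ℚ
κ-norm≡0⇒odd≡0 u ra≡0 rc≡0 =
  square+nonNeg≡0⇒≡0 (b u) (d u ℚ.* d u) {{square-nonNeg (d u)}} N≡0 ,
  square+nonNeg≡0⇒≡0 (d u) (b u ℚ.* b u) {{square-nonNeg (b u)}}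
    (trans (ℚ.+-comm (d u ℚ.* d u) (b u ℚ.* b u)) N≡0)
  where
  open ≡-Reasoning
  ρ = coordinates u 0K 0K
  α₀ = aᴱ uᴱ; α₁ = bᴱ uᴱ; α₂ = cᴱ uᴱ; α₃ = dᴱ uᴱ
  eᴱ fᴱ Nᴱ Xᴱ Yᴱ : Expr ℚ 12
  eᴱ = α₀ ⊗ α₁ ⊕ α₂ ⊗ α₃
  fᴱ = α₂ ⊗ α₁ ⊕ ⊝ (α₀ ⊗ α₃)
  Nᴱ = α₁ ⊗ α₁ ⊕ α₃ ⊗ α₃
  Xᴱ = α₁ ⊗ α₁ ⊕ ⊝ (α₃ ⊗ α₃)
  Yᴱ = Κ 2ℚ ⊗ (α₁ ⊗ α₃)
  e f N X Y : ℚ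
  e = ⟦ eᴱ ⟧ℚ ρ; f = ⟦ fᴱ ⟧ℚ ρ; N = ⟦ Nᴱ ⟧ℚ ρ; X = ⟦ Xᴱ ⟧ℚ ρ; Y = ⟦ Yᴱ ⟧ℚ ρ
  e² : e ℚ.* e ≡ f ℚ.* f ℚ.+ a (u * κ u) ℚ.* X ℚ.+ c (u * κ u) ℚ.* Y
  e² = prove ρ (eᴱ ⊗ eᴱ) (fᴱ ⊗ fᴱ ⊕ aᴱ (uᴱ ⊠ κᴱ uᴱ) ⊗ Xᴱ ⊕ cᴱ (uᴱ ⊠ κᴱ uᴱ) ⊗ Yᴱ) refl
  2ef : 2ℚ ℚ.* (e ℚ.* f) ≡ N ℚ.* N ℚ.+ c (u * κ u) ℚ.* X ℚ.+ ℚ.- (a (u * κ u) ℚ.* Y)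
  2ef = prove ρ (Κ 2ℚ ⊗ (eᴱ ⊗ fᴱ)) (Nᴱ ⊗ Nᴱ ⊕ cᴱ (uᴱ ⊠ κᴱ uᴱ) ⊗ Xᴱ ⊕ ⊝ (aᴱ (uᴱ ⊠ κᴱ uᴱ) ⊗ Yᴱ)) refl
  drop₁ : ∀ x X Y → x ℚ.+ 0ℚ ℚ.* X ℚ.+ 0ℚ ℚ.* Y ≡ x
  drop₁ = solve-∀ ℚ-ring
  drop₂ : ∀ x X Y → x ℚ.+ 0ℚ ℚ.* X ℚ.+ ℚ.- (0ℚ ℚ.* Y) ≡ x
  drop₂ = solve-∀ ℚ-ring
  N≡0 : N ≡ 0ℚ
  N≡0 = e²≡f²∧2ef≡N²⇒N≡0 e f N
    (begin
      e ℚ.* e                                                  ≡⟨ e² ⟩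
      f ℚ.* f ℚ.+ a (u * κ u) ℚ.* X ℚ.+ c (u * κ u) ℚ.* Y     ≡⟨ cong₂ (λ s t → f ℚ.* f ℚ.+ s ℚ.* X ℚ.+ t ℚ.* Y)
                                                                    ra≡0 rc≡0 ⟩
      f ℚ.* f ℚ.+ 0ℚ ℚ.* X ℚ.+ 0ℚ ℚ.* Y                       ≡⟨ drop₁ (f ℚ.* f) X Y ⟩
      f ℚ.* f                                                  ∎)
    (begin
      2ℚ ℚ.* (e ℚ.* f)                                             ≡⟨ 2ef ⟩
      N ℚ.* N ℚ.+ c (u * κ u) ℚ.* X ℚ.+ ℚ.- (a (u * κ u) ℚ.* Y)  ≡⟨ cong₂ (λ s t → N ℚ.* N ℚ.+ t ℚ.* X ℚ.+ ℚ.- (s ℚ.* Y))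
                                                                        ra≡0 rc≡0 ⟩
      N ℚ.* N ℚ.+ 0ℚ ℚ.* X ℚ.+ ℚ.- (0ℚ ℚ.* Y)                    ≡⟨ drop₂ (N ℚ.* N) X Y ⟩
      N ℚ.* N                                                      ∎)

-- Multiplying by ζ moves the even coordinates of u to odd positions and
-- multiplies u κ(u) by -i.
κ-norm≡0⇒≡0 : ∀ u → a (u * κ u) ≡ 0ℚ → c (u * κ u) ≡ 0ℚ → u ≡ 0K
κ-norm≡0⇒≡0 u ra≡0 rc≡0 =
  K-≡ (trans (sym b-ζu) (proj₁ even)) (proj₁ odd) (trans (sym d-ζu) (proj₂ even)) (proj₂ odd)
  where
  ρ = coordinates u 0K 0K
  ζuᴱ = constᴱ ζ₈ ⊠ uᴱ
  ζu = ζ₈ * u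
  odd = κ-norm≡0⇒odd≡0 u ra≡0 rc≡0
  ra′ : a (ζu * κ ζu) ≡ c (u * κ u)
  ra′ = prove ρ (aᴱ (ζuᴱ ⊠ κᴱ ζuᴱ)) (cᴱ (uᴱ ⊠ κᴱ uᴱ)) refl
  rc′ : c (ζu * κ ζu) ≡ ℚ.- a (u * κ u)
  rc′ = prove ρ (cᴱ (ζuᴱ ⊠ κᴱ ζuᴱ)) (⊝ aᴱ (uᴱ ⊠ κᴱ uᴱ)) refl
  even = κ-norm≡0⇒odd≡0 ζu (trans ra′ rc≡0) (trans rc′ (cong ℚ.-_ ra≡0))
  b-ζu : b ζu ≡ a u
  b-ζu = prove ρ (bᴱ ζuᴱ) (aᴱ uᴱ) refl
  d-ζu : d ζu ≡ c u
  d-ζu = prove ρ (dᴱ ζuᴱ) (cᴱ uᴱ) refl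

invℚ-inverseʳ : ∀ q → q ≢ 0ℚ → q ℚ.* invℚ q ≡ 1ℚ
invℚ-inverseʳ q q≢0 with q ℚ.≟ 0ℚ
... | yes q≡0  = contradiction q≡0 q≢0
... | no  q≢0′ = ℚ.*-inverseʳ q {{ℚ.≢-nonZero q≢0′}}

*-inverseʳ : ∀ u → u ≢ 0K → u * invK u ≡ 1K
*-inverseʳ u u≢0 = begin
  u * invK u                 ≡⟨ regroup u (κ u) r̄ (fromℚ (invℚ n)) ⟩
  (r * r̄) * fromℚ (invℚ n)  ≡⟨ cong (_* fromℚ (invℚ n)) rr̄≡n ⟩
  fromℚ n * fromℚ (invℚ n)  ≡⟨ fromℚ-* n (invℚ n) ⟩
  fromℚ (n ℚ.* invℚ n)      ≡⟨ cong fromℚ (invℚ-inverseʳ n n≢0) ⟩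
  1K                         ∎
  where
  open ≡-Reasoning
  regroup : ∀ u v w x → u * ((v * w) * x) ≡ ((u * v) * w) * x
  regroup = solve-∀ K-ring
  r = u * κ u
  r̄ = i-conjugate r
  n = a (r * r̄)
  s = a r
  t = c r
  rr̄≡s²+t² : r * r̄ ≡ fromℚ (s ℚ.* s ℚ.+ t ℚ.* t)
  rr̄≡s²+t² = trans (cong (_* r̄) r≡s+ti) (i-norm s t)
    where
    r≡s+ti : r ≡ mkK s 0ℚ t 0ℚ
    r≡s+ti = K-≡ refl (proj₁ (κ-norm-even u)) refl (proj₂ (κ-norm-even u))
  rr̄≡n : r * r̄ ≡ fromℚ n
  rr̄≡n = trans rr̄≡s²+t² (cong fromℚ (sym (cong a rr̄≡s²+t²)))
  n≢0 : n ≢ 0ℚ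
  n≢0 n≡0 = u≢0 (κ-norm≡0⇒≡0 u s≡0 t≡0)
    where
    s²+t²≡0 = trans (sym (cong a rr̄≡s²+t²)) n≡0
    s≡0 = square+nonNeg≡0⇒≡0 s (t ℚ.* t) {{square-nonNeg t}} s²+t²≡0
    t≡0 = square+nonNeg≡0⇒≡0 t (s ℚ.* s) {{square-nonNeg s}} (trans (ℚ.+-comm (t ℚ.* t) (s ℚ.* s)) s²+t²≡0)

*-zeroʳ : ∀ u → u * 0K ≡ 0K
*-zeroʳ = solve-∀ K-ring

*-zero-product : ∀ u v → u * v ≡ 0K → u ≡ 0K ⊎ v ≡ 0K
*-zero-product u v uv≡0 with u ≟K 0K
... | yes u≡0 = inj₁ u≡0
... | no  u≢0 = inj₂ (begin
  v                 ≡⟨ *-identityˡ v ⟨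
  1K * v            ≡⟨ cong (_* v) (*-inverseʳ u u≢0) ⟨
  (u * invK u) * v  ≡⟨ regroup u (invK u) v ⟩
  invK u * (u * v)  ≡⟨ cong (invK u *_) uv≡0 ⟩
  invK u * 0K       ≡⟨ *-zeroʳ (invK u) ⟩
  0K                ∎)
  where
  open ≡-Reasoning
  regroup : ∀ u w v → (u * w) * v ≡ w * (u * v)
  regroup = solve-∀ K-ring

*-nonzero : ∀ u v → u ≢ 0K → v ≢ 0K → u * v ≢ 0K
*-nonzero u v u≢0 v≢0 uv≡0 = [ u≢0 , v≢0 ]′ (*-zero-product u v uv≡0)

/-*-cancel : ∀ u v → v ≢ 0K → (u /K v) * v ≡ u
/-*-cancel u v v≢0 = begin
  (u * invK v) * v  ≡⟨ regroup u (invK v) v ⟩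
  u * (v * invK v)  ≡⟨ cong (u *_) (*-inverseʳ v v≢0) ⟩
  u * 1K            ≡⟨ *-identityʳ u ⟩
  u                 ∎
  where
  open ≡-Reasoning
  regroup : ∀ u w v → (u * w) * v ≡ u * (v * w)
  regroup = solve-∀ K-ring

*-cancelʳ : ∀ u v w → w ≢ 0K → u * w ≡ v * w → u ≡ v
*-cancelʳ u v w w≢0 uw≡vw =
  [ K-+.x∙y⁻¹≈ε⇒x≈y u v , (λ w≡0 → contradiction w≡0 w≢0) ]′ (*-zero-product (u - v) w (begin
    (u - v) * w    ≡⟨ distrib u v w ⟩
    u * w - v * w  ≡⟨ cong (_- v * w) uw≡vw ⟩
    v * w - v * w  ≡⟨ -‿inverseʳ (v * w) ⟩
    0K             ∎))
  where
  open ≡-Reasoning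
  distrib : ∀ u v w → (u - v) * w ≡ u * w - v * w
  distrib = solve-∀ K-ring

u+u≡0⇒u≡0 : ∀ u → u + u ≡ 0K → u ≡ 0K
u+u≡0⇒u≡0 u u+u≡0 = [ (λ ()) , (λ u≡0 → u≡0) ]′ (*-zero-product 2K u (trans (double u) u+u≡0))
  where
  double : ∀ u → 2K * u ≡ u + u
  double = solve-∀ K-ring

u≡-u⇒u≡0 : ∀ u → u ≡ - u → u ≡ 0K
u≡-u⇒u≡0 u u≡-u = u+u≡0⇒u≡0 u (trans (cong (u +_) u≡-u) (-‿inverseʳ u))

-- Polynomials over K as coefficient lists, constant term first.
Poly : Set
Poly = List K

eval : Poly → K → K
eval []      x = 0K
eval (e ∷ p) x = e + x * eval p x

add-constant : K → Poly → Poly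
add-constant e []      = e ∷ []
add-constant e (e′ ∷ p) = e + e′ ∷ p

-- Multiplication by X - r.
times-linear : K → Poly → Poly
times-linear r []      = []
times-linear r (e ∷ p) = - r * e ∷ add-constant e (times-linear r p)

scale : K → Poly → Poly
scale k = map (k *_)

linear-product : List K → Poly
linear-product = foldr times-linear (1K ∷ [])

eval-add-constant : ∀ e p x → eval (add-constant e p) x ≡ e + eval p x
eval-add-constant e []       x = cong (e +_) (*-zeroʳ x)
eval-add-constant e (e′ ∷ p) x = +-assoc e e′ (x * eval p x)

eval-times-linear : ∀ r p x → eval (times-linear r p) x ≡ (x - r) * eval p x
eval-times-linear r []      x = sym (*-zeroʳ (x - r))
eval-times-linear r (e ∷ p) x = begin
  - r * e + x * eval (add-constant e (times-linear r p)) x  ≡⟨ cong (λ t → - r * e + x * t)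
                                                                (eval-add-constant e (times-linear r p) x) ⟩
  - r * e + x * (e + eval (times-linear r p) x)            ≡⟨ cong (λ t → - r * e + x * (e + t))
                                                                (eval-times-linear r p x) ⟩
  - r * e + x * (e + (x - r) * eval p x)                   ≡⟨ expand r e x (eval p x) ⟩
  (x - r) * (e + x * eval p x)                              ∎
  where
  open ≡-Reasoning
  expand : ∀ r e x q → - r * e + x * (e + (x - r) * q) ≡ (x - r) * (e + x * q)
  expand = solve-∀ K-ring

eval-scale : ∀ k p x → eval (scale k p) x ≡ k * eval p x
eval-scale k []      x = sym (*-zeroʳ k)
eval-scale k (e ∷ p) x = trans (cong (λ t → k * e + x * t) (eval-scale k p x)) (factor k e x (eval p x))
  where
  factor : ∀ k e x q → k * e + x * (k * q) ≡ k * (e + x * q)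
  factor = solve-∀ K-ring

linear-product-root : ∀ rs z → eval (linear-product rs) z ≡ 0K → z ∈ rs
linear-product-root []       z 1≡0 = contradiction (trans (sym (one z)) 1≡0) λ ()
  where
  one : ∀ z → 1K + z * 0K ≡ 1K
  one = solve-∀ K-ring
linear-product-root (r ∷ rs) z p≡0 =
  [ (λ z-r≡0 → here (K-+.x∙y⁻¹≈ε⇒x≈y z r z-r≡0)) , (λ q≡0 → there (linear-product-root rs z q≡0)) ]′
  (*-zero-product (z - r) (eval (linear-product rs) z)
    (trans (sym (eval-times-linear r (linear-product rs) z)) p≡0))

_≟Poly_ : DecidableEquality Poly
_≟Poly_ = List.≡-dec _≟K_

module Weierstrass (A B : K) where

  cubic : K → K
  cubic x = x * (x * x) + B * x

  -- The sum of (x₁, y₁) and (x₂, y₂) along a line of slope l.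
  sum-x : K → K → K → K
  sum-x l x₁ x₂ = A * l * l - (x₁ + x₂)

  sum-y : K → K → K → K → K
  sum-y l x₁ x₂ y₁ = - (y₁ + l * (sum-x l x₁ x₂ - x₁))

  -- For a root e of the cubic, the roots of halving-polynomial e are the
  -- x-coordinates of the points P with [2]P = (e, 0).
  halving-polynomial : K → K → K
  halving-polynomial e x = x * x - 2K * e * x - 2K * e * e - B

  cubic-coefficients : Poly
  cubic-coefficients = 0K ∷ B ∷ 0K ∷ 1K ∷ []

  halving-coefficients : K → Poly
  halving-coefficients e = - (2K * e * e) - B ∷ - (2K * e) ∷ 1K ∷ []

  ordinate-coefficients : K → Poly
  ordinate-coefficients x = - cubic x ∷ 0K ∷ A ∷ []

-- The polynomial identities below are stated with the definitions of Weierstrass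
-- unfolded, as solve-∀ only sees ring operations.
eval-cubic-coefficients : ∀ B x → 0K + x * (B + x * (0K + x * (1K + x * 0K))) ≡ x * (x * x) + B * x
eval-cubic-coefficients = solve-∀ K-ring

eval-halving-coefficients : ∀ B e x → - (2K * e * e) - B + x * (- (2K * e) + x * (1K + x * 0K))
                         ≡ x * x - 2K * e * x - 2K * e * e - B
eval-halving-coefficients = solve-∀ K-ring

eval-ordinate-coefficients : ∀ A c y → - c + y * (0K + y * (A + y * 0K)) ≡ A * (y * y) - c
eval-ordinate-coefficients = solve-∀ K-ring

halving-identity : ∀ A B x y l → let x₂ = A * l * l - (x + x); y₂ = - (y + l * (x₂ - x)) in
  x * x - 2K * x₂ * x - 2K * x₂ * x₂ - B ≡ (l * (2K * A * y) - (3K * (x * x) + B)) + 2K * A * l * y₂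
halving-identity = solve-∀ K-ring

cubic-identity : ∀ A B x y l → let x₂ = A * l * l - (x + x); y₂ = - (y + l * (x₂ - x)) in
  x₂ * (x₂ * x₂) + B * x₂ ≡ (A * (y₂ + 2K * l * (x₂ - x)) + 2K * A * l * (x - x₂)) * y₂
                            - (A * (y * y) - (x * (x * x) + B * x))
                            + (x - x₂) * (l * (2K * A * y) - (3K * (x * x) + B))
cubic-identity = solve-∀ K-ring

chord-identity : ∀ A x l₁ l₂ → A * l₂ * l₂ - (x + (A * l₁ * l₁ - (x + x))) - x ≡ A * ((l₂ - l₁) * (l₂ + l₁))
chord-identity = solve-∀ K-ring

aff-injective : ∀ {x y x′ y′} → aff x y ≡ aff x′ y′ → x ≡ x′ × y ≡ y′
aff-injective refl = refl , refl

_≟Pt_ : DecidableEquality Pt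
O       ≟Pt O         = yes refl
O       ≟Pt aff _ _   = no λ ()
aff _ _ ≟Pt O         = no λ ()
aff x y ≟Pt aff x′ y′ = map′ (λ (p , q) → cong₂ aff p q) aff-injective (x ≟K x′ ×-dec y ≟K y′)

on-curve? : ∀ C P → Dec (OnCurve C P)
on-curve? C O         = yes tt
on-curve? C (aff x y) = _ ≟K _

torsion? : ∀ C m P → Dec (Tors C m P)
torsion? C m P = on-curve? C P ×-dec mulPt C m P ≟Pt O

-- The roots e of the cubic, for each of them the roots x of halving-polynomial e,
-- and for each of those the ordinates y with A y² = cubic x.
Tower : Set
Tower = List (K × List (K × List K))

roots : Tower → List K
roots = map proj₁

two-torsion-points : Tower → List Pt
two-torsion-points t = O ∷ map (λ e → aff e 0K) (roots t)

halving-points : List (K × List K) → List Pt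
halving-points = concatMap λ (x , ys) → map (aff x) ys

four-torsion-points : Tower → List Pt
four-torsion-points t = two-torsion-points t ++ concatMap (λ (_ , xs) → halving-points xs) t

module Curve (C : CurveData) (α≢0 : α C ≢ 0ℚ) where

  open Weierstrass (fromℚ (α C)) (fromℚ (β C)) public

  A B : K
  A = fromℚ (α C)
  B = fromℚ (β C)

  A≢0 : A ≢ 0K
  A≢0 A≡0 = α≢0 (cong K.a A≡0)

  2Ay≢0 : ∀ y → y ≢ 0K → 2K * A * y ≢ 0K
  2Ay≢0 y y≢0 = *-nonzero (2K * A) y (*-nonzero 2K A (λ ()) A≢0) y≢0

  data SumView (x₁ y₁ x₂ y₂ : K) : Pt → Set where
    opposite : x₁ ≡ x₂ → y₁ + y₂ ≡ 0K → SumView x₁ y₁ x₂ y₂ O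
    chord    : ∀ l → x₁ ≢ x₂ → l * (x₂ - x₁) ≡ y₂ - y₁ →
               SumView x₁ y₁ x₂ y₂ (aff (sum-x l x₁ x₂) (sum-y l x₁ x₂ y₁))
    tangent  : ∀ l → x₁ ≡ x₂ → y₁ + y₂ ≢ 0K → (y₁ ≢ 0K → l * (2K * A * y₁) ≡ 3K * (x₁ * x₁) + B) →
               SumView x₁ y₁ x₂ y₂ (aff (sum-x l x₁ x₂) (sum-y l x₁ x₂ y₁))

  sum-view : ∀ x₁ y₁ x₂ y₂ → SumView x₁ y₁ x₂ y₂ (addPt C (aff x₁ y₁) (aff x₂ y₂))
  sum-view x₁ y₁ x₂ y₂ with x₁ ≟K x₂
  ... | no x₁≢x₂ = chord ((y₂ - y₁) /K (x₂ - x₁)) x₁≢x₂ (/-*-cancel (y₂ - y₁) (x₂ - x₁) x₂-x₁≢0)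
    where
    x₂-x₁≢0 : x₂ - x₁ ≢ 0K
    x₂-x₁≢0 x₂-x₁≡0 = x₁≢x₂ (sym (K-+.x∙y⁻¹≈ε⇒x≈y x₂ x₁ x₂-x₁≡0))
  ... | yes refl with (y₁ + y₂) ≟K 0K
  ...   | yes y₁+y₂≡0 = opposite refl y₁+y₂≡0
  -- The tangent slope is spelled as in addPt: unfolding A and B inside the
  -- conversion check against addPt is very slow.
  ...   | no  y₁+y₂≢0 = tangent ((3K * (x₁ * x₁) + fromℚ (β C)) /K (2K * fromℚ (α C) * y₁)) refl y₁+y₂≢0 λ y₁≢0 →
    /-*-cancel (3K * (x₁ * x₁) + B) (2K * A * y₁) (2Ay≢0 y₁ y₁≢0)

  sum≡O⇒opposite : ∀ x y Q → addPt C (aff x y) Q ≡ O → Q ≡ aff x (- y)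
  sum≡O⇒opposite x y (aff x₂ y₂) sum≡O = from-view (sum-view x y x₂ y₂) sum≡O
    where
    from-view : ∀ {S} → SumView x y x₂ y₂ S → S ≡ O → aff x₂ y₂ ≡ aff x (- y)
    from-view (opposite x≡x₂ y+y₂≡0) _ = cong₂ aff (sym x≡x₂) (K-+.inverseʳ-unique y y₂ y+y₂≡0)

  2-torsion⇒y≡0 : ∀ x y → mulPt C 2 (aff x y) ≡ O → y ≡ 0K
  2-torsion⇒y≡0 x y 2P≡O = u≡-u⇒u≡0 y (proj₂ (aff-injective (sum≡O⇒opposite x y (aff x y) 2P≡O)))

  doubling-to-2-torsion : ∀ x y l → A * (y * y) ≡ cubic x → l * (2K * A * y) ≡ 3K * (x * x) + B →
    sum-y l x x y ≡ 0K → cubic (sum-x l x x) ≡ 0K × halving-polynomial (sum-x l x x) x ≡ 0K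
  doubling-to-2-torsion x y l on slope y₂≡0 = cubic≡0 , halving≡0
    where
    open ≡-Reasoning
    x₂ = sum-x l x x
    y₂ = sum-y l x x y
    on-defect≡0 : A * (y * y) - cubic x ≡ 0K
    on-defect≡0 = K-+.x≈y⇒x∙y⁻¹≈ε on
    tangent-defect≡0 : l * (2K * A * y) - (3K * (x * x) + B) ≡ 0K
    tangent-defect≡0 = K-+.x≈y⇒x∙y⁻¹≈ε slope
    halving≡0 = begin
      halving-polynomial x₂ x                                      ≡⟨ halving-identity A B x y l ⟩
      (l * (2K * A * y) - (3K * (x * x) + B)) + 2K * A * l * y₂   ≡⟨ cong₂ (λ s t → s + 2K * A * l * t)
                                                                        tangent-defect≡0 y₂≡0 ⟩
      0K + 2K * A * l * 0K                                         ≡⟨ vanish (2K * A * l) ⟩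
      0K                                                            ∎
      where
      vanish : ∀ k → 0K + k * 0K ≡ 0K
      vanish = solve-∀ K-ring
    cubic≡0 = begin
      cubic x₂                                                 ≡⟨ cubic-identity A B x y l ⟩
      k * y₂ - (A * (y * y) - cubic x) + (x - x₂) * (l * (2K * A * y) - (3K * (x * x) + B))
        ≡⟨ cong₂ (λ s t → k * s - t + (x - x₂) * (l * (2K * A * y) - (3K * (x * x) + B))) y₂≡0 on-defect≡0 ⟩
      k * 0K - 0K + (x - x₂) * (l * (2K * A * y) - (3K * (x * x) + B))
        ≡⟨ cong (λ r → k * 0K - 0K + (x - x₂) * r) tangent-defect≡0 ⟩
      k * 0K - 0K + (x - x₂) * 0K                              ≡⟨ vanish k (x - x₂) ⟩
      0K                                                        ∎
      where
      k = A * (y₂ + 2K * l * (x₂ - x)) + 2K * A * l * (x - x₂)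
      vanish : ∀ k k′ → k * 0K - 0K + k′ * 0K ≡ 0K
      vanish = solve-∀ K-ring

  -- The chord through P = (x, y) and [2]P = (x₂, y₂) meets the curve again above x
  -- only if its slope is ± the tangent slope; the sign - would force y = 0.
  chord-returning⇒y₂≡0 : ∀ x y l l′ → y ≢ 0K →
    l′ * (sum-x l x x - x) ≡ sum-y l x x y - y → sum-x l′ x (sum-x l x x) ≡ x → sum-y l x x y ≡ 0K
  chord-returning⇒y₂≡0 x y l l′ y≢0 slope′ returns =
    [ (λ A≡0 → contradiction A≡0 A≢0)
    , (λ slopes≡0 → [ same-slope , (λ l′+l≡0 → contradiction (opposite-slope l′+l≡0) y≢0) ]′
                      (*-zero-product (l′ - l) (l′ + l) slopes≡0))
    ]′ (*-zero-product A ((l′ - l) * (l′ + l))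
         (trans (sym (chord-identity A x l l′)) (K-+.x≈y⇒x∙y⁻¹≈ε returns)))
    where
    open ≡-Reasoning
    D = sum-x l x x - x
    y₂ = sum-y l x x y

    same-slope : l′ - l ≡ 0K → y₂ ≡ 0K
    same-slope l′-l≡0 = u≡-u⇒u≡0 y₂ (begin
      y₂                    ≡⟨⟩
      - (y + l * D)         ≡⟨ cong (λ l″ → - (y + l″ * D)) (K-+.x∙y⁻¹≈ε⇒x≈y l′ l l′-l≡0) ⟨
      - (y + l′ * D)        ≡⟨ cong (λ t → - (y + t)) slope′ ⟩
      - (y + (y₂ - y))      ≡⟨ cancel y y₂ ⟩
      - y₂                  ∎)
      where
      cancel : ∀ y y₂ → - (y + (y₂ - y)) ≡ - y₂
      cancel = solve-∀ K-ring

    opposite-slope : l′ + l ≡ 0K → y ≡ 0K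
    opposite-slope l′+l≡0 = u≡-u⇒u≡0 y (begin
      y                     ≡⟨ cancel₁ y y₂ ⟩
      y₂ - (y₂ - y)         ≡⟨ cong (λ t → y₂ - t) slope′ ⟨
      y₂ - l′ * D           ≡⟨ cong (λ l″ → y₂ - l″ * D) (K-+.inverseˡ-unique l′ l l′+l≡0) ⟩
      y₂ - (- l) * D        ≡⟨ cancel₂ y l D ⟩
      - y                   ∎)
      where
      cancel₁ : ∀ y y₂ → y ≡ y₂ - (y₂ - y)
      cancel₁ = solve-∀ K-ring
      cancel₂ : ∀ y l D → - (y + l * D) - (- l) * D ≡ - y
      cancel₂ = solve-∀ K-ring

  [3]P≡-P⇒[2]P-has-y≡0 : ∀ x y l → y ≢ 0K → l * (2K * A * y) ≡ 3K * (x * x) + B →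
    addPt C (aff x y) (aff (sum-x l x x) (sum-y l x x y)) ≡ aff x (- y) → sum-y l x x y ≡ 0K
  [3]P≡-P⇒[2]P-has-y≡0 x y l y≢0 slope 3P≡-P = from-view (sum-view x y x₂ y₂) 3P≡-P
    where
    x₂ = sum-x l x x
    y₂ = sum-y l x x y
    from-view : ∀ {T} → SumView x y x₂ y₂ T → T ≡ aff x (- y) → y₂ ≡ 0K
    from-view (chord l′ _ slope′) T≡-P =
      chord-returning⇒y₂≡0 x y l l′ y≢0 slope′ (proj₁ (aff-injective T≡-P))
    from-view (tangent l′ x≡x₂ y+y₂≢0 slope′) T≡-P = contradiction y+y₂≡0 y+y₂≢0
      where
      l′≡l : l′ ≡ l
      l′≡l = *-cancelʳ l′ l (2K * A * y) (2Ay≢0 y y≢0) (trans (slope′ y≢0) (sym slope))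
      y₂≡-y : y₂ ≡ - y
      y₂≡-y = trans (sym (cong₂ (λ l″ z → sum-y l″ x z y) l′≡l (sym x≡x₂))) (proj₂ (aff-injective T≡-P))
      y+y₂≡0 : y + y₂ ≡ 0K
      y+y₂≡0 = trans (cong (y +_) y₂≡-y) (-‿inverseʳ y)

  4-torsion⇒halving : ∀ x y → OnCurve C (aff x y) → mulPt C 4 (aff x y) ≡ O →
    y ≡ 0K ⊎ ∃[ e ] cubic e ≡ 0K × halving-polynomial e x ≡ 0K
  4-torsion⇒halving x y on 4P≡O = after-doubling (sum-view x y x y) (sum≡O⇒opposite x y _ 4P≡O)
    where
    after-doubling : ∀ {D} → SumView x y x y D → addPt C (aff x y) D ≡ aff x (- y) →
      y ≡ 0K ⊎ ∃[ e ] cubic e ≡ 0K × halving-polynomial e x ≡ 0K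
    after-doubling (opposite _ y+y≡0)      _      = inj₁ (u+u≡0⇒u≡0 y y+y≡0)
    after-doubling (chord _ x≢x _)         _      = contradiction refl x≢x
    after-doubling (tangent l _ y+y≢0 slope) 3P≡-P =
      inj₂ (sum-x l x x , doubling-to-2-torsion x y l on (slope y≢0)
                            ([3]P≡-P⇒[2]P-has-y≡0 x y l y≢0 (slope y≢0) 3P≡-P))
      where
      y≢0 : y ≢ 0K
      y≢0 y≡0 = y+y≢0 (trans (cong (λ u → u + u) y≡0) (+-identityʳ 0K))

  Splits : Tower → Set
  Splits t = cubic-coefficients ≡ linear-product (roots t)
           × All (λ (e , xs) → halving-coefficients e ≡ linear-product (map proj₁ xs)
                             × All (λ (x , ys) → ordinate-coefficients x ≡ scale A (linear-product ys)) xs) t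

  splits? : ∀ t → Dec (Splits t)
  splits? t =
    cubic-coefficients ≟Poly linear-product (roots t)
    ×-dec all? (λ (e , xs) → halving-coefficients e ≟Poly linear-product (map proj₁ xs)
                            ×-dec all? (λ (x , ys) → ordinate-coefficients x ≟Poly scale A (linear-product ys)) xs) t

  module _ {t : Tower} (splits : Splits t) where

    root⇒∈ : ∀ e → cubic e ≡ 0K → e ∈ roots t
    root⇒∈ e cubic≡0 = linear-product-root (roots t) e (begin
      eval (linear-product (roots t)) e  ≡⟨ cong (λ p → eval p e) (proj₁ splits) ⟨
      eval cubic-coefficients e          ≡⟨ eval-cubic-coefficients B e ⟩
      cubic e                            ≡⟨ cubic≡0 ⟩
      0K                                 ∎)
      where open ≡-Reasoning

    on-curve∧y≡0⇒∈ : ∀ x y → OnCurve C (aff x y) → y ≡ 0K → aff x y ∈ two-torsion-points t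
    on-curve∧y≡0⇒∈ x y on refl = there (∈-map⁺ (λ e → aff e 0K) (root⇒∈ x (trans (sym on) (vanish A))))
      where
      vanish : ∀ A → A * (0K * 0K) ≡ 0K
      vanish = solve-∀ K-ring

    2-torsion-complete : ∀ P → Tors C 2 P → P ∈ two-torsion-points t
    2-torsion-complete O         _           = here refl
    2-torsion-complete (aff x y) (on , 2P≡O) = on-curve∧y≡0⇒∈ x y on (2-torsion⇒y≡0 x y 2P≡O)

    ordinate⇒∈ : ∀ x y ys → OnCurve C (aff x y) → ordinate-coefficients x ≡ scale A (linear-product ys) →
      y ∈ ys
    ordinate⇒∈ x y ys on ordinate-splits =
      linear-product-root ys y ([ (λ A≡0 → contradiction A≡0 A≢0) , (λ ys≡0 → ys≡0) ]′
        (*-zero-product A _ (begin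
          A * eval (linear-product ys) y        ≡⟨ eval-scale A (linear-product ys) y ⟨
          eval (scale A (linear-product ys)) y  ≡⟨ cong (λ p → eval p y) ordinate-splits ⟨
          eval (ordinate-coefficients x) y      ≡⟨ eval-ordinate-coefficients A (cubic x) y ⟩
          A * (y * y) - cubic x                 ≡⟨ K-+.x≈y⇒x∙y⁻¹≈ε on ⟩
          0K                                    ∎)))
      where open ≡-Reasoning

    halving⇒∈ : ∀ x y → OnCurve C (aff x y) → ∀ e → cubic e ≡ 0K → halving-polynomial e x ≡ 0K →
      aff x y ∈ concatMap (λ (_ , xs) → halving-points xs) t
    halving⇒∈ x y on e cubic≡0 halving≡0 = over-root (∈-map⁻ proj₁ (root⇒∈ e cubic≡0))
      where
      open ≡-Reasoning
      over-root : ∃ (λ exs → exs ∈ t × e ≡ proj₁ exs) → aff x y ∈ concatMap (λ (_ , xs) → halving-points xs) t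
      over-root ((_ , xs) , exs∈t , refl) =
        ∈-concatMap⁺ _ (lose exs∈t (over-halving (All.lookup (proj₂ splits) exs∈t)))
        where
        over-halving : halving-coefficients e ≡ linear-product (map proj₁ xs)
                     × All (λ (x , ys) → ordinate-coefficients x ≡ scale A (linear-product ys)) xs →
                     aff x y ∈ halving-points xs
        over-halving (halving-splits , ordinate-splits) = at-x (∈-map⁻ proj₁ (linear-product-root _ x (begin
          eval (linear-product (map proj₁ xs)) x  ≡⟨ cong (λ p → eval p x) halving-splits ⟨
          eval (halving-coefficients e) x         ≡⟨ eval-halving-coefficients B e x ⟩
          halving-polynomial e x                  ≡⟨ halving≡0 ⟩
          0K                                      ∎)))
          where
          at-x : ∃ (λ xys → xys ∈ xs × x ≡ proj₁ xys) → aff x y ∈ halving-points xs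
          at-x ((_ , ys) , xys∈xs , refl) =
            ∈-concatMap⁺ _ (lose xys∈xs (∈-map⁺ (aff x) (ordinate⇒∈ x y ys on (All.lookup ordinate-splits xys∈xs))))

    4-torsion-complete : ∀ P → Tors C 4 P → P ∈ four-torsion-points t
    4-torsion-complete O         _           = here refl
    4-torsion-complete (aff x y) (on , 4P≡O) =
      [ (λ y≡0 → ∈-++⁺ˡ (on-curve∧y≡0⇒∈ x y on y≡0))
      , (λ (e , cubic≡0 , halving≡0) → ∈-++⁺ʳ (two-torsion-points t) (halving⇒∈ x y on e cubic≡0 halving≡0))
      ]′ (4-torsion⇒halving x y on 4P≡O)

  κ+1-Table : Tower → Set
  κ+1-Table t = All (λ P → Tors C 2 (κ+1 C P)) (four-torsion-points t)
              × All (λ P → κ+1 C P ≡ O → Tors C 2 P) (four-torsion-points t)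
              × All (λ Q → Any (λ P → κ+1 C P ≡ Q × Tors C 4 P) (four-torsion-points t)) (two-torsion-points t)
              × All (Kernel4 C) (two-torsion-points t)

  -- In the search for preimages the cheap test κ+1 C P ≡ Q comes first, so that
  -- [4]P is only evaluated at the preimage found.
  κ+1-table? : ∀ t → Dec (κ+1-Table t)
  κ+1-table? t =
    all? (λ P → torsion? C 2 (κ+1 C P)) (four-torsion-points t)
    ×-dec all? (λ P → (κ+1 C P ≟Pt O) →-dec torsion? C 2 P) (four-torsion-points t)
    ×-dec all? (λ Q → any? (λ P → κ+1 C P ≟Pt Q ×-dec torsion? C 4 P) (four-torsion-points t))
               (two-torsion-points t)
    ×-dec all? (λ P → torsion? C 4 P ×-dec κ+1 C P ≟Pt O) (two-torsion-points t)

  verified? : ∀ t → Dec (Splits t × κ+1-Table t)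
  verified? t = splits? t ×-dec κ+1-table? t

  image-and-kernel : ∀ t → Splits t × κ+1-Table t → (Image4 C ≐ Tors C 2) × (Kernel4 C ≐ Tors C 2)
  image-and-kernel t (splits , image⊆ , kernel⊆ , preimages , kernel⊇) = image , kernel
    where
    image : Image4 C ≐ Tors C 2
    image Q = mk⇔
      (λ (P , P∈C[4] , P↦Q) → subst (Tors C 2) P↦Q (All.lookup image⊆ (4-torsion-complete splits P P∈C[4])))
      (λ Q∈C[2] → let P , P↦Q , P∈C[4] = satisfied (All.lookup preimages (2-torsion-complete splits Q Q∈C[2]))
                  in P , P∈C[4] , P↦Q)
    kernel : Kernel4 C ≐ Tors C 2
    kernel P = mk⇔
      (λ (P∈C[4] , P↦O) → All.lookup kernel⊆ (4-torsion-complete splits P P∈C[4]) P↦O)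
      (λ P∈C[2] → All.lookup kernel⊇ (2-torsion-complete splits P P∈C[2]))

-1ℚ -2ℚ : ℚ
-1ℚ = ℚ.- 1ℚ
-2ℚ = ℚ.- 2ℚ

towerA : Tower
towerA =
    (mkK 0ℚ 0ℚ 0ℚ 0ℚ ,
       (mkK 1ℚ 0ℚ 0ℚ 0ℚ , mkK 1ℚ 0ℚ 0ℚ 0ℚ ∷ mkK -1ℚ 0ℚ 0ℚ 0ℚ ∷ []) ∷
       (mkK -1ℚ 0ℚ 0ℚ 0ℚ , mkK 0ℚ 0ℚ 1ℚ 0ℚ ∷ mkK 0ℚ 0ℚ -1ℚ 0ℚ ∷ []) ∷ []) ∷
    (mkK 0ℚ 0ℚ 1ℚ 0ℚ ,
       (mkK 0ℚ 1ℚ 1ℚ 1ℚ , mkK -1ℚ 0ℚ 1ℚ 1ℚ ∷ mkK 1ℚ 0ℚ -1ℚ -1ℚ ∷ []) ∷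
       (mkK 0ℚ -1ℚ 1ℚ -1ℚ , mkK -1ℚ 0ℚ 1ℚ -1ℚ ∷ mkK 1ℚ 0ℚ -1ℚ 1ℚ ∷ []) ∷ []) ∷
    (mkK 0ℚ 0ℚ -1ℚ 0ℚ ,
       (mkK 0ℚ 1ℚ -1ℚ 1ℚ , mkK -1ℚ 1ℚ -1ℚ 0ℚ ∷ mkK 1ℚ -1ℚ 1ℚ 0ℚ ∷ []) ∷
       (mkK 0ℚ -1ℚ -1ℚ -1ℚ , mkK -1ℚ -1ℚ -1ℚ 0ℚ ∷ mkK 1ℚ 1ℚ 1ℚ 0ℚ ∷ []) ∷ []) ∷ []

towerE : Tower
towerE =
    (mkK 0ℚ 0ℚ 0ℚ 0ℚ ,
       (mkK 0ℚ 0ℚ 1ℚ 0ℚ , mkK -1ℚ 0ℚ 1ℚ 0ℚ ∷ mkK 1ℚ 0ℚ -1ℚ 0ℚ ∷ []) ∷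
       (mkK 0ℚ 0ℚ -1ℚ 0ℚ , mkK -1ℚ 0ℚ -1ℚ 0ℚ ∷ mkK 1ℚ 0ℚ 1ℚ 0ℚ ∷ []) ∷ []) ∷
    (mkK 1ℚ 0ℚ 0ℚ 0ℚ ,
       (mkK 1ℚ 1ℚ 0ℚ -1ℚ , mkK -2ℚ -1ℚ 0ℚ 1ℚ ∷ mkK 2ℚ 1ℚ 0ℚ -1ℚ ∷ []) ∷
       (mkK 1ℚ -1ℚ 0ℚ 1ℚ , mkK -2ℚ 1ℚ 0ℚ -1ℚ ∷ mkK 2ℚ -1ℚ 0ℚ 1ℚ ∷ []) ∷ []) ∷
    (mkK -1ℚ 0ℚ 0ℚ 0ℚ ,
       (mkK -1ℚ 1ℚ 0ℚ -1ℚ , mkK 0ℚ -1ℚ 2ℚ -1ℚ ∷ mkK 0ℚ 1ℚ -2ℚ 1ℚ ∷ []) ∷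
       (mkK -1ℚ -1ℚ 0ℚ 1ℚ , mkK 0ℚ -1ℚ -2ℚ -1ℚ ∷ mkK 0ℚ 1ℚ 2ℚ 1ℚ ∷ []) ∷ []) ∷ []

module A-curve = Curve curveA (λ ())
module E-curve = Curve curveE (λ ())

lemma3p17 : ((Image4 curveA ≐ Tors curveA 2) × (Kernel4 curveA ≐ Tors curveA 2))
          × ((Image4 curveE ≐ Tors curveE 2) × (Kernel4 curveE ≐ Tors curveE 2))
lemma3p17 =
  A-curve.image-and-kernel towerA (from-yes (A-curve.verified? towerA)) ,
  E-curve.image-and-kernel towerE (from-yes (E-curve.verified? towerE))
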